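{- Let $\mathcal{P}$ be a profile of unrooted phylogenetic trees whose display graph $G(\mathcal{P})$ is connected. Let $F$ be any minimal separator of the edge label intersection graph $L(\mathcal{P})$ and let $u$ be any vertex of any input tree. Then $\hat{K}(u)\not\subseteq F$, where $\hat{K}(u)$ is the set of all vertices $e$ of $L(\mathcal{P})$ (i.e. edges of input trees) with $u\in e$.
   Context: A phylogenetic tree is an unrooted tree whose leaves are bijectively labeled; a profile $\mathcal{P}$ is a finite collection of phylogenetic trees. The display graph $G(\mathcal{P})$ is the union of the trees of $\mathcal{P}$, where leaves with the same label in different trees are identified and all other vertices of different trees are distinct. The edge label intersection graph $L(\mathcal{P})$ is the line graph of $G(\mathcal{P})$: its vertices are the edges of the input trees, two adjacent iff they share an endpoint. A minimal separator of a graph $G$ is a vertex set $U$ that is, for some nonadjacent vertices $a,b$, an $a$-$b$ separator (i.e. $a,b$ lie in different components of $G-U$) no proper subset of which is an $a$-$b$ separator. -}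

module Defs where

open import Data.Nat using (ℕ; zero; suc; _≤_)
open import Data.Fin using (Fin; zero; suc; inject₁; fromℕ; _<_)
open import Data.Bool using (Bool; true; false; T)
open import Data.Maybe using (Maybe; just; nothing)
open import Data.Product using (Σ; ∃; _×_; _,_)
open import Data.Sum using (_⊎_)
open import Data.Empty using (⊥)
open import Relation.Nullary using (¬_)
open import Relation.Binary.PropositionalEquality using (_≡_; _≢_)
open import Relation.Binary.Construct.Closure.ReflexiveTransitive using (Star)
open import Function.Definitions using (Injective)

Adj : {N : ℕ} → (Fin N → Fin N → Bool) → Fin N → Fin N → Set
Adj adj u v = T (adj u v)

-- a cycle of length L = k + 3 ≥ 3: distinct vertices c 0, …, c (L-1),
-- consecutive ones adjacent, and c (L-1) adjacent to c 0
record Cycle {N : ℕ} (adj : Fin N → Fin N → Bool) : Set where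
  field
    k     : ℕ
    c     : Fin (suc (suc (suc k))) → Fin N
    inj   : Injective _≡_ _≡_ c
    step  : ∀ (j : Fin (suc (suc k))) → Adj adj (c (inject₁ j)) (c (suc j))
    close : Adj adj (c (fromℕ (suc (suc k)))) (c zero)

record PhyloTree (n : ℕ) : Set where
  field
    N          : ℕ
    nonempty   : 1 ≤ N
    adj        : Fin N → Fin N → Bool
    symmetric  : ∀ u v → adj u v ≡ adj v u
    irreflexive : ∀ u → adj u u ≡ false
    connected  : ∀ u v → Star (Adj adj) u v
    acyclic    : ¬ Cycle adj
    lab        : Fin N → Maybe (Fin n)

  IsLeaf : Fin N → Set
  IsLeaf v = ∀ w w' → Adj adj v w → Adj adj v w' → w ≡ w'

  field
    leaf-labelled   : ∀ v → IsLeaf v → ∃ λ x → lab v ≡ just x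
    labelled-leaf   : ∀ v x → lab v ≡ just x → IsLeaf v
    lab-injective   : ∀ v w x → lab v ≡ just x → lab w ≡ just x → v ≡ w

open PhyloTree public

record Profile : Set where
  field
    n     : ℕ
    k     : ℕ
    tree  : Fin k → PhyloTree n

open Profile public

module _ (P : Profile) where

  -- vertices of the input trees (before identification)
  TV : Set
  TV = Σ (Fin (k P)) (λ i → Fin (N (tree P i)))

  -- the identification defining the display graph G(P):
  -- equal vertices, or leaves carrying the same label
  data SameVertex : TV → TV → Set where
    same  : ∀ {x} → SameVertex x x
    glued : ∀ {i v j w x} → lab (tree P i) v ≡ just x → lab (tree P j) w ≡ just x
          → SameVertex (i , v) (j , w)

  data TreeAdj : TV → TV → Set where
    edge : ∀ {i v w} → Adj (adj (tree P i)) v w → TreeAdj (i , v) (i , w)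

  DisplayConnected : Set
  DisplayConnected = ∀ a b → Star (λ x y → SameVertex x y ⊎ TreeAdj x y) a b

  -- vertices of L(P): edges of input trees, written as (i , u , v) with u < v
  LV : Set
  LV = Σ (Fin (k P)) (λ i → Fin (N (tree P i)) × Fin (N (tree P i)))

  IsLEdge : LV → Set
  IsLEdge (i , u , v) = u < v × Adj (adj (tree P i)) u v

  Inc : LV → TV → Set
  Inc (i , u , v) x = SameVertex (i , u) x ⊎ SameVertex (i , v) x

  LAdj : LV → LV → Set
  LAdj e f = IsLEdge e × IsLEdge f × e ≢ f × ∃ λ x → Inc e x × Inc f x

  -- subsets of V(L(P)) are predicates on LV (restricted to edges)
  SubsetL : (LV → Set) → (LV → Set) → Set
  SubsetL U W = ∀ e → IsLEdge e → U e → W e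

  Separates : (LV → Set) → LV → LV → Set
  Separates U a b = ¬ U a × ¬ U b
    × ¬ Star (λ x y → LAdj x y × ¬ U x × ¬ U y) a b

  -- minimal a-b separator for some nonadjacent vertices a, b of L(P)
  MinimalSeparator : (LV → Set) → Set₁
  MinimalSeparator U = SubsetL U IsLEdge × ∃ λ a → ∃ λ b →
    IsLEdge a × IsLEdge b × ¬ LAdj a b × Separates U a b
    × (∀ U' → SubsetL U' U → (∃ λ e → IsLEdge e × U e × ¬ U' e) → ¬ Separates U' a b)

  Khat : TV → LV → Set
  Khat u e = IsLEdge e × Inc e u

-- If K̂(u) ⊆ F, pick an edge f at u (it exists as G(P) is connected) and use the
-- minimality of F: some a–b walk avoids F ∖ {f}, hence passes through f. Its
-- neighbours g, h of f on the walk lie outside F ⊇ K̂(u), so they meet f at its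
-- endpoint other than u; thus g and h share that endpoint and the walk can skip f,
-- giving an a–b walk avoiding F.
module Submission where

open import Defs
open import Data.Product using (_×_; ∃; _,_; proj₁; proj₂)
open import Data.Product.Properties using (≡-dec)
open import Data.Sum using (_⊎_; inj₁; inj₂)
open import Data.Empty using (⊥-elim)
open import Data.Bool using (T)
open import Data.Maybe using (just)
open import Data.Maybe.Properties using (just-injective)
open import Data.Fin.Properties using (_≟_; <-cmp)
open import Relation.Nullary using (¬_; yes; no)
open import Level using (0ℓ)
open import Function using (_∘_)
open import Relation.Binary using (Rel; Symmetric; DecidableEquality; tri<; tri≈; tri>)
open import Relation.Binary.PropositionalEquality using (_≡_; _≢_; refl; sym; trans; cong; subst)
open import Relation.Binary.Construct.Closure.ReflexiveTransitive using (Star; ε; _◅_; _◅◅_; reverse)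

_∖｛_｝ : {A : Set} → (A → Set) → A → (A → Set)
(F ∖｛ f ｝) x = F x × x ≢ f

module _ {A : Set} (E : Rel A 0ℓ) where

  Avoiding : (A → Set) → Rel A 0ℓ
  Avoiding U x y = E x y × ¬ U x × ¬ U y

  Avoiding-sym : Symmetric E → ∀ U → Symmetric (Avoiding U)
  Avoiding-sym E-sym U (e , ¬Ux , ¬Uy) = E-sym e , ¬Uy , ¬Ux

  module _ (_≟ᴬ_ : DecidableEquality A) (F : A → Set) (f : A) where

    private
      ¬F : ∀ {x} → ¬ (F ∖｛ f ｝) x → x ≢ f → ¬ F x
      ¬F ¬F∖f x≢f Fx = ¬F∖f (Fx , x≢f)

    walk-avoids-or-enters : ∀ {x y} → Star (Avoiding (F ∖｛ f ｝)) x y → ¬ F x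
      → Star (Avoiding F) x y ⊎ ∃ λ g → Star (Avoiding F) x g × E g f × ¬ F g
    walk-avoids-or-enters ε ¬Fx = inj₁ ε
    walk-avoids-or-enters {x} (_◅_ {j = z} (xz , _ , ¬F∖fz) rest) ¬Fx with z ≟ᴬ f
    ... | yes refl = inj₂ (x , ε , xz , ¬Fx)
    ... | no z≢f with walk-avoids-or-enters rest (¬F ¬F∖fz z≢f)
    ...   | inj₁ p = inj₁ ((xz , ¬Fx , ¬F ¬F∖fz z≢f) ◅ p)
    ...   | inj₂ (g , p , gf , ¬Fg) = inj₂ (g , (xz , ¬Fx , ¬F ¬F∖fz z≢f) ◅ p , gf , ¬Fg)

module _ (P : Profile) where

  SameVertex-sym : ∀ {x y} → SameVertex P x y → SameVertex P y x
  SameVertex-sym same = same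
  SameVertex-sym (glued lx ly) = glued ly lx

  SameVertex-trans : ∀ {x y z} → SameVertex P x y → SameVertex P y z → SameVertex P x z
  SameVertex-trans same s = s
  SameVertex-trans (glued lx ly) same = glued lx ly
  SameVertex-trans (glued lx ly) (glued ly' lz) =
    glued lx (trans lz (cong just (just-injective (trans (sym ly') ly))))

  Inc-resp : ∀ {e x y} → Inc P e x → SameVertex P x y → Inc P e y
  Inc-resp (inj₁ s) s' = inj₁ (SameVertex-trans s s')
  Inc-resp (inj₂ s) s' = inj₂ (SameVertex-trans s s')

  _≟ᴸ_ : DecidableEquality (LV P)
  _≟ᴸ_ = ≡-dec _≟_ (≡-dec _≟_ _≟_)

  LAdj-sym : Symmetric (LAdj P)
  LAdj-sym (ie , if , e≢f , x , iex , ifx) = if , ie , (λ p → e≢f (sym p)) , x , ifx , iex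

  Khat-nonempty-backward : ∀ {u t e} → Star (λ x y → SameVertex P x y ⊎ TreeAdj P x y) u t
    → Khat P t e → ∃ (Khat P u)
  Khat-nonempty-backward ε k = _ , k
  Khat-nonempty-backward (inj₁ s ◅ rest) k with Khat-nonempty-backward rest k
  ... | e , ie , inc = e , ie , Inc-resp inc (SameVertex-sym s)
  Khat-nonempty-backward (inj₂ (edge {i} {v} {w} vw) ◅ _) _ with <-cmp v w
  ... | tri< v<w _ _ = (i , v , w) , (v<w , vw) , inj₁ same
  ... | tri≈ _ refl _ = ⊥-elim (subst T (irreflexive (tree P i) v) vw)
  ... | tri> _ _ w<v = (i , w , v) , (w<v , subst T (symmetric (tree P i) v w) vw) , inj₂ same

  otherEnd : (f : LV P) → ∀ {u} → Inc P f u → TV P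
  otherEnd (i , p , q) (inj₁ _) = i , q
  otherEnd (i , p , q) (inj₂ _) = i , p

  Inc-otherEnd : (f : LV P) → ∀ {u g x} (fu : Inc P f u) → Inc P g x → Inc P f x
    → ¬ Inc P g u → Inc P g (otherEnd f fu)
  Inc-otherEnd _ (inj₁ s) gx (inj₁ s') ¬gu =
    ⊥-elim (¬gu (Inc-resp gx (SameVertex-trans (SameVertex-sym s') s)))
  Inc-otherEnd _ (inj₁ _) gx (inj₂ s') _   = Inc-resp gx (SameVertex-sym s')
  Inc-otherEnd _ (inj₂ _) gx (inj₁ s') _   = Inc-resp gx (SameVertex-sym s')
  Inc-otherEnd _ (inj₂ s) gx (inj₂ s') ¬gu =
    ⊥-elim (¬gu (Inc-resp gx (SameVertex-trans (SameVertex-sym s') s)))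

  bypass : ∀ {f u g h} → Inc P f u → LAdj P g f → LAdj P f h
    → ¬ Inc P g u → ¬ Inc P h u → g ≡ h ⊎ LAdj P g h
  bypass {f} {g = g} {h} fu (ig , _ , _ , x , gx , fx) (_ , ih , _ , y , fy , hy) ¬gu ¬hu
    with g ≟ᴸ h
  ... | yes g≡h = inj₁ g≡h
  ... | no g≢h = inj₂ (ig , ih , g≢h , otherEnd f fu
                      , Inc-otherEnd f fu gx fx ¬gu , Inc-otherEnd f fu hy fy ¬hu)

  module _ {F : LV P → Set} {u : TV P} (K̂u⊆F : SubsetL P (Khat P u) F) where

    private
      ¬Inc-u : ∀ {g f} → LAdj P g f → ¬ F g → ¬ Inc P g u
      ¬Inc-u (ig , _) ¬Fg gu = ¬Fg (K̂u⊆F _ ig (ig , gu))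

      reverse-avoiding : ∀ {U x y} → Star (Avoiding (LAdj P) U) x y → Star (Avoiding (LAdj P) U) y x
      reverse-avoiding = reverse (Avoiding-sym (LAdj P) LAdj-sym _)

    skip-edge-at : ∀ {f a b} → Inc P f u → ¬ F a → ¬ F b
      → Star (Avoiding (LAdj P) (F ∖｛ f ｝)) a b → Star (Avoiding (LAdj P) F) a b
    skip-edge-at {f} fu ¬Fa ¬Fb a⇝b
      with walk-avoids-or-enters (LAdj P) _≟ᴸ_ F f a⇝b ¬Fa
         | walk-avoids-or-enters (LAdj P) _≟ᴸ_ F f (reverse-avoiding a⇝b) ¬Fb
    ... | inj₁ p | _ = p
    ... | _ | inj₁ p = reverse-avoiding p
    ... | inj₂ (g , a⇝g , gf , ¬Fg) | inj₂ (h , b⇝h , hf , ¬Fh)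
      with bypass fu gf (LAdj-sym hf) (¬Inc-u gf ¬Fg) (¬Inc-u hf ¬Fh)
    ... | inj₁ refl = a⇝g ◅◅ reverse-avoiding b⇝h
    ... | inj₂ gh = a⇝g ◅◅ (gh , ¬Fg , ¬Fh) ◅ reverse-avoiding b⇝h

lemma1 : (P : Profile) → DisplayConnected P → (F : LV P → Set) → MinimalSeparator P F
    → (u : TV P) → ¬ SubsetL P (Khat P u) F
lemma1 P connected F (_ , a@(i , v , _) , b , ia , _ , _ , (¬Fa , ¬Fb , ¬a⇝b) , minimal) u K̂u⊆F
  with Khat-nonempty-backward P (connected u (i , v)) (ia , inj₁ same)
... | f , if , fu =
  minimal (F ∖｛ f ｝) (λ _ _ → proj₁) (f , if , K̂u⊆F f if (if , fu) , λ Ff∖f → proj₂ Ff∖f refl)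
    ((¬Fa ∘ proj₁) , (¬Fb ∘ proj₁) , ¬a⇝b ∘ skip-edge-at P K̂u⊆F fu ¬Fa ¬Fb)
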